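{- In intensional Martin-Löf type theory with weak propositional truncation, for every type $X:\mathcal U$ the following three types are logically equivalent: (1) $\mathrm{Pop}(X):\equiv\prod_{f:X\to X}\Big(\big(\prod_{x,y:X}f(x)=f(y)\big)\to\sum_{x:X}x=f(x)\Big)$; (2) $\big\lVert\, \lVert X\rVert\to X\,\big\rVert\to\lVert X\rVert$; (3) $(\lVert X\rVert\to X)\to X$.
   Context: Intensional Martin-Löf type theory with a universe $\mathcal U$, $\Sigma$, $\Pi$, $+$ and identity types (J only; no UIP/K). $\mathrm{isProp}(A):\equiv\prod_{a,b:A}a=b$. Weak propositional truncation: for every $A:\mathcal U$ a type $\lVert A\rVert:\mathcal U$ with $|{ - }|:A\to\lVert A\rVert$, a proof of $\mathrm{isProp}(\lVert A\rVert)$, and $\mathrm{rec}:\prod_{P:\mathcal U}\mathrm{isProp}(P)\to(A\to P)\to\lVert A\rVert\to P$ (no judgmental computation rule). Logically equivalent: functions between any two in both directions. -}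

{-# OPTIONS --without-K #-}
module Defs where

open import Relation.Binary.PropositionalEquality using (_≡_)
open import Data.Product using (Σ; _×_)

isProp : Set → Set
isProp A = (a b : A) → a ≡ b

-- Weak propositional truncation (no computation rule), as an assumed structure
record PropTrunc : Set₁ where
  field
    ∥_∥      : Set → Set
    ∣_∣      : {A : Set} → A → ∥ A ∥
    ∥∥-isProp : {A : Set} → isProp ∥ A ∥
    rec      : {A : Set} (P : Set) → isProp P → (A → P) → ∥ A ∥ → P

_↔_ : Set → Set → Set
A ↔ B = (A → B) × (B → A)

Pop : Set → Set
Pop X = (f : X → X) → ((x y : X) → f x ≡ f y) → Σ X (λ x → x ≡ f x)

module _ (pt : PropTrunc) where
  open PropTrunc pt

  Cond2 : Set → Set
  Cond2 X = ∥ (∥ X ∥ → X) ∥ → ∥ X ∥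

  Cond3 : Set → Set
  Cond3 X = (∥ X ∥ → X) → X

{-# OPTIONS --without-K #-}
-- A weakly constant endomap f has at most one fixed point: by weak constancy every
-- path cong f r is determined by its endpoints, which pins down the second component.
-- Hence whenever X is merely inhabited, the fixed points of f, being a proposition,
-- are reached from ∥ X ∥ by rec applied to x ↦ f x.  This turns Cond3 into Pop;
-- conversely a map g : ∥ X ∥ → X gives the weakly constant g ∘ ∣_∣, whose fixed point
-- solves Cond3.  Cond2 and Cond3 differ only by a truncation on a proposition.
module Submission where

open import Defs
open import Data.Product using (Σ; _×_; _,_; proj₁)
open import Function using (_∘_)
open import Relation.Binary.PropositionalEquality

module _ {X : Set} where

  WeaklyConstant : (X → X) → Set
  WeaklyConstant f = (x y : X) → f x ≡ f y

  Fix : (X → X) → Set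
  Fix f = Σ X (λ x → x ≡ f x)

  sym[p∙sym-q]∙p≡q : {x y z : X} (p : x ≡ z) (q : y ≡ z) →
                     trans (sym (trans p (sym q))) p ≡ q
  sym[p∙sym-q]∙p≡q refl refl = refl

  module _ {f : X → X} (c : WeaklyConstant f) where

    cong-weaklyConstant : {x y : X} (r : x ≡ y) →
                          cong f r ≡ trans (sym (c x x)) (c x y)
    cong-weaklyConstant {x} refl = sym (trans-symˡ (c x x))

    Fix-≡ : {x y : X} {p : x ≡ f x} {q : y ≡ f y} (r : x ≡ y) →
            trans (sym r) (trans p (cong f r)) ≡ q → (x , p) ≡ (y , q)
    Fix-≡ {p = p} refl e = cong (_ ,_) (trans (sym (trans-reflʳ p)) e)

    Fix-isProp : isProp (Fix f)
    Fix-isProp (x , p) (y , q) = Fix-≡ r (begin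
        trans (sym r) (trans p (cong f r))  ≡⟨ cong (trans (sym r) ∘ trans p) (cong-weaklyConstant r) ⟩
        trans (sym r) s                     ≡⟨ sym[p∙sym-q]∙p≡q s q ⟩
        q                                   ∎)
      where
      open ≡-Reasoning
      s : x ≡ f y
      s = trans p (trans (sym (c x x)) (c x y))
      r : x ≡ y
      r = trans s (sym q)

module _ (pt : PropTrunc) {X : Set} where
  open PropTrunc pt

  ∥∥-fix : {f : X → X} → WeaklyConstant f → ∥ X ∥ → Fix f
  ∥∥-fix {f} c = rec (Fix f) (Fix-isProp c) (λ x → f x , c x (f x))

  ∘∣∣-weaklyConstant : (g : ∥ X ∥ → X) → WeaklyConstant (g ∘ ∣_∣)
  ∘∣∣-weaklyConstant g x y = cong g (∥∥-isProp ∣ x ∣ ∣ y ∣)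

  Cond2⇒Cond3 : Cond2 pt X → Cond3 pt X
  Cond2⇒Cond3 h g = g (h ∣ g ∣)

  Cond3⇒Cond2 : Cond3 pt X → Cond2 pt X
  Cond3⇒Cond2 h = rec ∥ X ∥ ∥∥-isProp (∣_∣ ∘ h)

  Pop⇒Cond3 : Pop X → Cond3 pt X
  Pop⇒Cond3 pop g = proj₁ (pop (g ∘ ∣_∣) (∘∣∣-weaklyConstant g))

  Cond3⇒Pop : Cond3 pt X → Pop X
  Cond3⇒Pop h f c = ∥∥-fix c ∣ h (proj₁ ∘ ∥∥-fix c) ∣

lemma6p3 : (pt : PropTrunc) (X : Set) →
    (Pop X ↔ Cond2 pt X) × (Cond2 pt X ↔ Cond3 pt X) × (Pop X ↔ Cond3 pt X)
lemma6p3 pt X =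
    (Cond3⇒Cond2 pt ∘ Pop⇒Cond3 pt , Cond3⇒Pop pt ∘ Cond2⇒Cond3 pt)
  , (Cond2⇒Cond3 pt , Cond3⇒Cond2 pt)
  , (Pop⇒Cond3 pt , Cond3⇒Pop pt)
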